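{- Let $g$ be an $n$-variable Boolean function and $b\in\mathbb{F}_2$. Define the $(n+1)$-variable Boolean function $$g_b(X_{n+1},X_n,\ldots,X_1)=(1\oplus X_{n+1})\,g(X_n,\ldots,X_1)\oplus X_{n+1}\big(b\oplus g(1\oplus X_n,\ldots,1\oplus X_1)\big).$$ Then: (1) for every $\boldsymbol{\beta}=(a,\boldsymbol{\alpha})\in\mathbb{F}_2^{n+1}$ with $a\in\mathbb{F}_2$ (the coordinate paired with $X_{n+1}$) and $\boldsymbol{\alpha}\in\mathbb{F}_2^n$, $$W_{g_b}(\boldsymbol{\beta})=\frac{1+(-1)^{b+\mathrm{wt}(\boldsymbol{\beta})}}{2}\,W_g(\boldsymbol{\alpha});$$ (2) $H_\infty(g_b)=H_\infty(g)$; (3) $\mathrm{Inf}(g_b)=\mathrm{Inf}(g)+\epsilon_b(g)$, where $\epsilon_b(g)=\sum_{\boldsymbol{\alpha}\in\mathbb{F}_2^n,\ \mathrm{wt}(\boldsymbol{\alpha})\not\equiv b \pmod 2}W_g^2(\boldsymbol{\alpha})$.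
   Context: Logarithms are base $2$; $\mathrm{wt}$ is Hamming weight. For an $m$-variable Boolean function $f:\mathbb{F}_2^m\to\mathbb{F}_2$: the Walsh transform is $W_f(\boldsymbol{\alpha})=2^{ -m}\sum_{\mathbf{x}}(-1)^{f(\mathbf{x})\oplus\langle\mathbf{x},\boldsymbol{\alpha}\rangle}$ with $\langle\mathbf{x},\boldsymbol{\alpha}\rangle=\bigoplus_j x_j\alpha_j$ (vectors indexed consistently with the variable order); the min-entropy is $H_\infty(f)=\min_{\boldsymbol{\alpha}:W_f^2(\boldsymbol{\alpha})\neq0}\log\frac{1}{W_f^2(\boldsymbol{\alpha})}$; the (total) influence is $\mathrm{Inf}(f)=\sum_{i=1}^m\Pr_{\mathbf{x}}[f(\mathbf{x})\neq f(\mathbf{x}\oplus\mathbf{e}_i)]$ with $\mathbf{x}$ uniform in $\mathbb{F}_2^m$ and $\mathbf{e}_i$ the $i$-th unit vector. -}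

module Defs where

open import Data.Bool using (Bool; true; false; not; _xor_; _∧_; if_then_else_)
open import Data.Nat as ℕ using (ℕ; zero; suc)
open import Data.Fin using (Fin)
open import Data.Vec as Vec using (Vec; []; _∷_)
open import Data.List as List using (List; []; _∷_)
open import Data.Rational using (ℚ; 0ℚ; 1ℚ; -_; ½; _+_; _*_; _⊔_)
open import Data.Rational.Properties using (_≟_)
open import Relation.Nullary using (¬?)

-- An m-variable Boolean function; Bool plays the role of F_2 (true = 1).
-- A vector (x_m, ..., x_1) is a Vec Bool m; head = highest-index variable.
BF : ℕ → Set
BF m = Vec Bool m → Bool

allVecs : (m : ℕ) → List (Vec Bool m)
allVecs zero    = [] ∷ []
allVecs (suc m) = List.map (false ∷_) (allVecs m) List.++ List.map (true ∷_) (allVecs m)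

Σℚ : ∀ {A : Set} → List A → (A → ℚ) → ℚ
Σℚ xs h = List.foldr (λ x acc → h x + acc) 0ℚ xs

b2n : Bool → ℕ
b2n false = 0
b2n true  = 1

wt : ∀ {m} → Vec Bool m → ℕ
wt []       = 0
wt (x ∷ xs) = b2n x ℕ.+ wt xs

parity : ℕ → Bool
parity zero    = false
parity (suc k) = not (parity k)

sgnℕ : ℕ → ℚ
sgnℕ k = if parity k then - 1ℚ else 1ℚ

sgn : Bool → ℚ
sgn b = if b then - 1ℚ else 1ℚ

inv2pow : ℕ → ℚ
inv2pow zero    = 1ℚ
inv2pow (suc m) = ½ * inv2pow m

dot : ∀ {m} → Vec Bool m → Vec Bool m → Bool
dot []       []       = false
dot (x ∷ xs) (a ∷ as) = (x ∧ a) xor dot xs as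

W : ∀ {m} → BF m → Vec Bool m → ℚ
W {m} f α = inv2pow m * Σℚ (allVecs m) (λ x → sgn (f x xor dot x α))

W² : ∀ {m} → BF m → Vec Bool m → ℚ
W² f α = W f α * W f α

-- Min-entropy, represented exponentially: 2^{-H∞(f)} = max { W_f²(α) : W_f(α) ≠ 0 }
-- (H∞(f) = min log(1/W²) = -log(max W²); log is injective, reals are unavailable).
twoPowNegMinEntropy : ∀ {m} → BF m → ℚ
twoPowNegMinEntropy {m} f =
  List.foldr (λ α acc → W² f α ⊔ acc) 0ℚ
    (List.filter (λ α → ¬? (W f α ≟ 0ℚ)) (allVecs m))

flipAt : ∀ {m} → Fin m → Vec Bool m → Vec Bool m
flipAt i x = Vec.updateAt x i not

b2q : Bool → ℚ
b2q false = 0ℚ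
b2q true  = 1ℚ

influenceAt : ∀ {m} → BF m → Fin m → ℚ
influenceAt {m} f i = inv2pow m * Σℚ (allVecs m) (λ x → b2q (f x xor f (flipAt i x)))

Inf : ∀ {m} → BF m → ℚ
Inf {m} f = Σℚ (List.allFin m) (influenceAt f)

ext : ∀ {n} → Bool → BF n → BF (suc n)
ext b g (false ∷ x) = g x
ext b g (true  ∷ x) = b xor g (Vec.map not x)

ε : ∀ {n} → Bool → BF n → ℚ
ε {n} b g = Σℚ (allVecs n) (λ α → if parity (wt α) xor b then W² g α else 0ℚ)

{-# OPTIONS --safe #-}
-- Encode f as the ±1-valued function (-1)^f; then W_f is its Fourier coefficient, an average
-- over F₂ⁿ which splits along the top variable into the two halves of g_b. On the X_{n+1} = 1
-- half, complementing every input multiplies the coefficient at α by (-1)^{wt α}, which gives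
-- (1): W_{g_b}(a, α) is W_g(α) or 0 according to the parity of b + a + wt α. Hence for each α
-- exactly one of (0, α), (1, α) carries W_g(α)², and (2) follows. For (3), flipping X_i with
-- i ≤ n flips it in both halves, and complementation is a bijection, so those influences are
-- those of g; flipping X_{n+1} compares g(x) with b ⊕ g(x̄), contributing ½(1 - (-1)^b C) with
-- C = E_x (-1)^{g(x) ⊕ g(x̄)}. The correlation identity Σ_α ĝ(α)² (-1)^{⟨e,α⟩} = E_x (-1)^{g(x) ⊕ g(x ⊕ e)}
-- at e = 0 (Parseval) and e = 1 shows that ε_b(g) has the same value.

module Submission where

open import Defs
open import Data.Bool using (Bool; true; false; not; _xor_; _∧_; if_then_else_)
open import Data.Bool.Properties using (xor-comm; xor-identityʳ; xor-annihilates-not; not-involutive)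
open import Data.Nat using (ℕ; zero; suc; _+_)
open import Data.Nat.Properties using (+-suc)
open import Data.Fin as Fin using (Fin)
open import Data.Vec as Vec using (Vec; []; _∷_; replicate)
open import Data.Vec.Properties using (map-∘; map-cong; map-id; map-updateAt; zipWith-identityʳ; zipWith-replicate₂)
open import Data.List as List using (List; []; _∷_; _++_)
open import Data.List.Properties using (map-tabulate)
open import Data.Product using (_×_; _,_)
open import Data.Integer using (+_; -[1+_])
open import Data.Rational using (ℚ; mkℚ; 0ℚ; 1ℚ; ½; -_; _⊔_; _≤_)
  renaming (_+_ to _+ℚ_; _*_ to _*ℚ_; _-_ to _-ℚ_)
open import Data.Rational.Properties
  using (_≟_; +-comm; +-assoc; +-identityˡ; *-zeroˡ; *-zeroʳ; *-identityˡ; *-distribˡ-+;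
         ≤-refl; p≤q⇒p⊔q≡q; p≥q⇒p⊔q≡p; p≤q⇒p≤r⊔q; ⊔-assoc; ⊔-commutativeSemigroup;
         nonNegative⁻¹; nonNeg*nonNeg⇒nonNeg)
open import Data.Rational.Solver using (module +-*-Solver)
open import Algebra.Properties.CommutativeSemigroup ⊔-commutativeSemigroup using (interchange)
open import Relation.Nullary using (¬?; yes; no)
open import Relation.Binary.PropositionalEquality
  using (_≡_; refl; sym; trans; cong; cong₂; subst; module ≡-Reasoning)

open +-*-Solver using (solve; _:+_; _:*_; _:-_; :-_; con; _:=_)
open ≡-Reasoning

-- Sums and averages over F₂ⁿ

Σ-cong : ∀ {A : Set} (xs : List A) {f h : A → ℚ} → (∀ x → f x ≡ h x) → Σℚ xs f ≡ Σℚ xs h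
Σ-cong []       f≡h = refl
Σ-cong (x ∷ xs) f≡h = cong₂ _+ℚ_ (f≡h x) (Σ-cong xs f≡h)

Σ-+ : ∀ {A : Set} (xs : List A) (f h : A → ℚ) → Σℚ xs (λ x → f x +ℚ h x) ≡ Σℚ xs f +ℚ Σℚ xs h
Σ-+ []       f h = refl
Σ-+ (x ∷ xs) f h = trans (cong ((f x +ℚ h x) +ℚ_) (Σ-+ xs f h)) (swap (f x) (h x) _ _)
  where
  swap : ∀ a b c d → (a +ℚ b) +ℚ (c +ℚ d) ≡ (a +ℚ c) +ℚ (b +ℚ d)
  swap = solve 4 (λ a b c d → (a :+ b) :+ (c :+ d) := (a :+ c) :+ (b :+ d)) refl

Σ-*ˡ : ∀ {A : Set} (xs : List A) (c : ℚ) (f : A → ℚ) → Σℚ xs (λ x → c *ℚ f x) ≡ c *ℚ Σℚ xs f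
Σ-*ˡ []       c f = sym (*-zeroʳ c)
Σ-*ˡ (x ∷ xs) c f = trans (cong ((c *ℚ f x) +ℚ_) (Σ-*ˡ xs c f)) (sym (*-distribˡ-+ c (f x) _))

Σ-linear : ∀ {A : Set} (xs : List A) (p q : ℚ) (f h : A → ℚ) →
  Σℚ xs (λ x → p *ℚ f x +ℚ q *ℚ h x) ≡ p *ℚ Σℚ xs f +ℚ q *ℚ Σℚ xs h
Σ-linear xs p q f h =
  trans (Σ-+ xs (λ x → p *ℚ f x) (λ x → q *ℚ h x)) (cong₂ _+ℚ_ (Σ-*ˡ xs p f) (Σ-*ˡ xs q h))

Σ-++ : ∀ {A : Set} (xs ys : List A) (f : A → ℚ) → Σℚ (xs ++ ys) f ≡ Σℚ xs f +ℚ Σℚ ys f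
Σ-++ []       ys f = sym (+-identityˡ _)
Σ-++ (x ∷ xs) ys f = trans (cong (f x +ℚ_) (Σ-++ xs ys f)) (sym (+-assoc (f x) _ _))

Σ-map : ∀ {A B : Set} (k : A → B) (xs : List A) (f : B → ℚ) → Σℚ (List.map k xs) f ≡ Σℚ xs (λ x → f (k x))
Σ-map k []       f = refl
Σ-map k (x ∷ xs) f = cong (f (k x) +ℚ_) (Σ-map k xs f)

Σ-allVecs-suc : ∀ n (f : Vec Bool (suc n) → ℚ) →
  Σℚ (allVecs (suc n)) f ≡ Σℚ (allVecs n) (λ x → f (false ∷ x)) +ℚ Σℚ (allVecs n) (λ x → f (true ∷ x))
Σ-allVecs-suc n f =
  trans (Σ-++ (List.map (false ∷_) (allVecs n)) _ f) (cong₂ _+ℚ_ (Σ-map _ (allVecs n) f) (Σ-map _ (allVecs n) f))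

Σ-allFin-suc : ∀ n (f : Fin (suc n) → ℚ) → Σℚ (List.allFin (suc n)) f ≡ f Fin.zero +ℚ Σℚ (List.allFin n) (λ i → f (Fin.suc i))
Σ-allFin-suc n f =
  cong (f Fin.zero +ℚ_) (trans (cong (λ is → Σℚ is f) (sym (map-tabulate (λ i → i) Fin.suc))) (Σ-map Fin.suc (List.allFin n) f))

½-double : ∀ p → ½ *ℚ (p +ℚ p) ≡ p
½-double = solve 1 (λ p → con ½ :* (p :+ p) := p) refl

mean : ∀ n → (Vec Bool n → ℚ) → ℚ
mean n f = inv2pow n *ℚ Σℚ (allVecs n) f

mean-cong : ∀ n {f h : Vec Bool n → ℚ} → (∀ x → f x ≡ h x) → mean n f ≡ mean n h
mean-cong n f≡h = cong (inv2pow n *ℚ_) (Σ-cong (allVecs n) f≡h)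

mean-*ˡ : ∀ n (c : ℚ) (f : Vec Bool n → ℚ) → mean n (λ x → c *ℚ f x) ≡ c *ℚ mean n f
mean-*ˡ n c f = trans (cong (inv2pow n *ℚ_) (Σ-*ˡ (allVecs n) c f)) (swap (inv2pow n) c _)
  where
  swap : ∀ a b d → a *ℚ (b *ℚ d) ≡ b *ℚ (a *ℚ d)
  swap = solve 3 (λ a b d → a :* (b :* d) := b :* (a :* d)) refl

mean-suc : ∀ n (f : Vec Bool (suc n) → ℚ) →
  mean (suc n) f ≡ ½ *ℚ (mean n (λ x → f (false ∷ x)) +ℚ mean n (λ x → f (true ∷ x)))
mean-suc n f = trans (cong (½ *ℚ inv2pow n *ℚ_) (Σ-allVecs-suc n f)) (distrib ½ (inv2pow n) _ _)
  where
  distrib : ∀ h i p q → h *ℚ i *ℚ (p +ℚ q) ≡ h *ℚ (i *ℚ p +ℚ i *ℚ q)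
  distrib = solve 4 (λ h i p q → h :* i :* (p :+ q) := h :* (i :* p :+ i :* q)) refl

mean-const : ∀ n (c : ℚ) → mean n (λ _ → c) ≡ c
mean-const zero    c = solve 1 (λ c → con 1ℚ :* (c :+ con 0ℚ) := c) refl c
mean-const (suc n) c = begin
  mean (suc n) (λ _ → c)                         ≡⟨ mean-suc n (λ _ → c) ⟩
  ½ *ℚ (mean n (λ _ → c) +ℚ mean n (λ _ → c))    ≡⟨ cong (λ m → ½ *ℚ (m +ℚ m)) (mean-const n c) ⟩
  ½ *ℚ (c +ℚ c)                                  ≡⟨ ½-double c ⟩
  c                                              ∎

mean-affine : ∀ n (p q : ℚ) (f : Vec Bool n → ℚ) → mean n (λ x → p +ℚ q *ℚ f x) ≡ p +ℚ q *ℚ mean n f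
mean-affine n p q f = begin
  inv2pow n *ℚ Σℚ (allVecs n) (λ x → p +ℚ q *ℚ f x)
    ≡⟨ cong (inv2pow n *ℚ_) (Σ-+ (allVecs n) (λ _ → p) (λ x → q *ℚ f x)) ⟩
  inv2pow n *ℚ (Σℚ (allVecs n) (λ _ → p) +ℚ Σℚ (allVecs n) (λ x → q *ℚ f x))
    ≡⟨ *-distribˡ-+ (inv2pow n) _ _ ⟩
  mean n (λ _ → p) +ℚ mean n (λ x → q *ℚ f x)
    ≡⟨ cong₂ _+ℚ_ (mean-const n p) (mean-*ˡ n q f) ⟩
  p +ℚ q *ℚ mean n f ∎

complement : ∀ {n} → Vec Bool n → Vec Bool n
complement = Vec.map not

complement-involutive : ∀ {n} (x : Vec Bool n) → complement (complement x) ≡ x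
complement-involutive x = trans (sym (map-∘ not not x)) (trans (map-cong not-involutive x) (map-id x))

mean-complement : ∀ n (f : Vec Bool n → ℚ) → mean n (λ x → f (complement x)) ≡ mean n f
mean-complement zero    f = refl
mean-complement (suc n) f = begin
  mean (suc n) (λ x → f (complement x))
    ≡⟨ mean-suc n (λ x → f (complement x)) ⟩
  ½ *ℚ (mean n (λ x → f (true ∷ complement x)) +ℚ mean n (λ x → f (false ∷ complement x)))
    ≡⟨ cong₂ (λ p q → ½ *ℚ (p +ℚ q)) (mean-complement n (λ x → f (true ∷ x))) (mean-complement n (λ x → f (false ∷ x))) ⟩
  ½ *ℚ (mean n (λ x → f (true ∷ x)) +ℚ mean n (λ x → f (false ∷ x)))
    ≡⟨ cong (½ *ℚ_) (+-comm (mean n (λ x → f (true ∷ x))) (mean n (λ x → f (false ∷ x)))) ⟩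
  ½ *ℚ (mean n (λ x → f (false ∷ x)) +ℚ mean n (λ x → f (true ∷ x)))
    ≡⟨ sym (mean-suc n f) ⟩
  mean (suc n) f ∎

-- The Walsh–Fourier transform

sgn-xor : ∀ p q → sgn (p xor q) ≡ sgn p *ℚ sgn q
sgn-xor false q     = sym (*-identityˡ _)
sgn-xor true  false = refl
sgn-xor true  true  = refl

sgn-not : ∀ p → sgn (not p) ≡ - 1ℚ *ℚ sgn p
sgn-not false = refl
sgn-not true  = refl

sgn-not-∧ : ∀ y a → sgn (not y ∧ a) ≡ sgn a *ℚ sgn (y ∧ a)
sgn-not-∧ false false = refl
sgn-not-∧ false true  = refl
sgn-not-∧ true  false = refl
sgn-not-∧ true  true  = refl

sgn² : ∀ p → sgn p *ℚ sgn p ≡ 1ℚ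
sgn² false = refl
sgn² true  = refl

sgnℕ-b2n+ : ∀ a k → sgnℕ (b2n a + k) ≡ sgn a *ℚ sgnℕ k
sgnℕ-b2n+ false k = sym (*-identityˡ _)
sgnℕ-b2n+ true  k = sgn-not (parity k)

b2q-xor : ∀ p q → b2q (p xor q) ≡ ½ *ℚ (1ℚ -ℚ sgn p *ℚ sgn q)
b2q-xor false false = refl
b2q-xor false true  = refl
b2q-xor true  false = refl
b2q-xor true  true  = refl

χ : ∀ {n} → Vec Bool n → Vec Bool n → ℚ
χ α x = sgn (dot x α)

χ-complement : ∀ {n} (α x : Vec Bool n) → χ α (complement x) ≡ sgnℕ (wt α) *ℚ χ α x
χ-complement []       []       = refl
χ-complement (a ∷ α) (y ∷ x) = begin
  sgn ((not y ∧ a) xor dot (complement x) α)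
    ≡⟨ sgn-xor (not y ∧ a) _ ⟩
  sgn (not y ∧ a) *ℚ χ α (complement x)
    ≡⟨ cong₂ _*ℚ_ (sgn-not-∧ y a) (χ-complement α x) ⟩
  (sgn a *ℚ sgn (y ∧ a)) *ℚ (sgnℕ (wt α) *ℚ χ α x)
    ≡⟨ solve 4 (λ s t w c → (s :* t) :* (w :* c) := (s :* w) :* (t :* c)) refl (sgn a) (sgn (y ∧ a)) (sgnℕ (wt α)) (χ α x) ⟩
  (sgn a *ℚ sgnℕ (wt α)) *ℚ (sgn (y ∧ a) *ℚ χ α x)
    ≡⟨ cong₂ _*ℚ_ (sym (sgnℕ-b2n+ a (wt α))) (sym (sgn-xor (y ∧ a) (dot x α))) ⟩
  sgnℕ (wt (a ∷ α)) *ℚ χ (a ∷ α) (y ∷ x) ∎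

fourier : ∀ n → (Vec Bool n → ℚ) → Vec Bool n → ℚ
fourier n u α = mean n (λ x → u x *ℚ χ α x)

W≡fourier : ∀ {n} (f : BF n) α → W f α ≡ fourier n (λ x → sgn (f x)) α
W≡fourier {n} f α = mean-cong n (λ x → sgn-xor (f x) (dot x α))

fourier-cong : ∀ n {u v : Vec Bool n → ℚ} → (∀ x → u x ≡ v x) → ∀ α → fourier n u α ≡ fourier n v α
fourier-cong n u≡v α = mean-cong n (λ x → cong (_*ℚ χ α x) (u≡v x))

fourier-*ˡ : ∀ n (c : ℚ) (u : Vec Bool n → ℚ) α → fourier n (λ x → c *ℚ u x) α ≡ c *ℚ fourier n u α
fourier-*ˡ n c u α =
  trans (mean-cong n (λ x → solve 3 (λ c u x → c :* u :* x := c :* (u :* x)) refl c (u x) (χ α x)))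
        (mean-*ˡ n c (λ x → u x *ℚ χ α x))

fourier-suc : ∀ n (u : Vec Bool (suc n) → ℚ) a α →
  fourier (suc n) u (a ∷ α) ≡ ½ *ℚ (fourier n (λ x → u (false ∷ x)) α +ℚ sgn a *ℚ fourier n (λ x → u (true ∷ x)) α)
fourier-suc n u a α = begin
  fourier (suc n) u (a ∷ α)
    ≡⟨ mean-suc n (λ x → u x *ℚ χ (a ∷ α) x) ⟩
  ½ *ℚ (fourier n (λ x → u (false ∷ x)) α +ℚ mean n (λ x → u (true ∷ x) *ℚ sgn (a xor dot x α)))
    ≡⟨ cong (λ m → ½ *ℚ (fourier n (λ x → u (false ∷ x)) α +ℚ m)) (trans (mean-cong n odd-half) (mean-*ˡ n (sgn a) _)) ⟩
  ½ *ℚ (fourier n (λ x → u (false ∷ x)) α +ℚ sgn a *ℚ fourier n (λ x → u (true ∷ x)) α) ∎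
  where
  odd-half : ∀ x → u (true ∷ x) *ℚ sgn (a xor dot x α) ≡ sgn a *ℚ (u (true ∷ x) *ℚ χ α x)
  odd-half x = trans (cong (u (true ∷ x) *ℚ_) (sgn-xor a (dot x α)))
                     (solve 3 (λ u s c → u :* (s :* c) := s :* (u :* c)) refl (u (true ∷ x)) (sgn a) (χ α x))

fourier-complement : ∀ n (u : Vec Bool n → ℚ) α → fourier n (λ x → u (complement x)) α ≡ sgnℕ (wt α) *ℚ fourier n u α
fourier-complement n u α = begin
  mean n (λ x → u (complement x) *ℚ χ α x)
    ≡⟨ mean-cong n (λ x → cong (λ y → u (complement x) *ℚ χ α y) (sym (complement-involutive x))) ⟩
  mean n (λ x → u (complement x) *ℚ χ α (complement (complement x)))
    ≡⟨ mean-complement n (λ y → u y *ℚ χ α (complement y)) ⟩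
  mean n (λ y → u y *ℚ χ α (complement y))
    ≡⟨ mean-cong n (λ y → trans (cong (u y *ℚ_) (χ-complement α y)) (swap (u y) (sgnℕ (wt α)) (χ α y))) ⟩
  mean n (λ y → sgnℕ (wt α) *ℚ (u y *ℚ χ α y))
    ≡⟨ mean-*ˡ n (sgnℕ (wt α)) (λ y → u y *ℚ χ α y) ⟩
  sgnℕ (wt α) *ℚ fourier n u α ∎
  where
  swap : ∀ a b d → a *ℚ (b *ℚ d) ≡ b *ℚ (a *ℚ d)
  swap = solve 3 (λ a b d → a :* (b :* d) := b :* (a :* d)) refl

walsh-ext : ∀ n (g : BF n) b a α → W (ext b g) (a ∷ α) ≡ ((1ℚ +ℚ sgnℕ (b2n b + wt (a ∷ α))) *ℚ ½) *ℚ W g α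
walsh-ext n g b a α = begin
  W (ext b g) (a ∷ α)
    ≡⟨ W≡fourier (ext b g) (a ∷ α) ⟩
  fourier (suc n) (λ x → sgn (ext b g x)) (a ∷ α)
    ≡⟨ fourier-suc n (λ x → sgn (ext b g x)) a α ⟩
  ½ *ℚ (Ŵ +ℚ sgn a *ℚ fourier n (λ x → sgn (b xor g (complement x))) α)
    ≡⟨ cong (λ t → ½ *ℚ (Ŵ +ℚ sgn a *ℚ t)) reflected ⟩
  ½ *ℚ (Ŵ +ℚ sgn a *ℚ (sgn b *ℚ (sgnℕ (wt α) *ℚ Ŵ)))
    ≡⟨ solve 4 (λ sa sb sw t → con ½ :* (t :+ sa :* (sb :* (sw :* t))) := ((con 1ℚ :+ sb :* (sa :* sw)) :* con ½) :* t)
               refl (sgn a) (sgn b) (sgnℕ (wt α)) Ŵ ⟩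
  ((1ℚ +ℚ sgn b *ℚ (sgn a *ℚ sgnℕ (wt α))) *ℚ ½) *ℚ Ŵ
    ≡⟨ cong₂ (λ s t → ((1ℚ +ℚ s) *ℚ ½) *ℚ t) (sym sign) (sym (W≡fourier g α)) ⟩
  ((1ℚ +ℚ sgnℕ (b2n b + wt (a ∷ α))) *ℚ ½) *ℚ W g α ∎
  where
  Ŵ : ℚ
  Ŵ = fourier n (λ x → sgn (g x)) α
  reflected : fourier n (λ x → sgn (b xor g (complement x))) α ≡ sgn b *ℚ (sgnℕ (wt α) *ℚ Ŵ)
  reflected = begin
    fourier n (λ x → sgn (b xor g (complement x))) α
      ≡⟨ fourier-cong n (λ x → sgn-xor b (g (complement x))) α ⟩
    fourier n (λ x → sgn b *ℚ sgn (g (complement x))) α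
      ≡⟨ fourier-*ˡ n (sgn b) (λ x → sgn (g (complement x))) α ⟩
    sgn b *ℚ fourier n (λ x → sgn (g (complement x))) α
      ≡⟨ cong (sgn b *ℚ_) (fourier-complement n (λ y → sgn (g y)) α) ⟩
    sgn b *ℚ (sgnℕ (wt α) *ℚ Ŵ) ∎
  sign : sgnℕ (b2n b + (b2n a + wt α)) ≡ sgn b *ℚ (sgn a *ℚ sgnℕ (wt α))
  sign = trans (sgnℕ-b2n+ b (b2n a + wt α)) (cong (sgn b *ℚ_) (sgnℕ-b2n+ a (wt α)))

fourier-product-suc : ∀ n (u v : Vec Bool (suc n) → ℚ) (c : Bool) (e α : Vec Bool n) →
  fourier (suc n) u (false ∷ α) *ℚ fourier (suc n) v (false ∷ α) *ℚ χ (false ∷ α) (c ∷ e)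
    +ℚ fourier (suc n) u (true ∷ α) *ℚ fourier (suc n) v (true ∷ α) *ℚ χ (true ∷ α) (c ∷ e)
  ≡ ½ *ℚ (fourier n (λ x → u (false ∷ x)) α *ℚ fourier n (λ x → v (c ∷ x)) α *ℚ χ α e
          +ℚ fourier n (λ x → u (true ∷ x)) α *ℚ fourier n (λ x → v (not c ∷ x)) α *ℚ χ α e)
fourier-product-suc n u v c e α = trans (cong₂ _+ℚ_ (expand false) (expand true)) (recombine c)
  where
  U V : Bool → ℚ
  U a = fourier n (λ x → u (a ∷ x)) α
  V a = fourier n (λ x → v (a ∷ x)) α
  expand : ∀ a → fourier (suc n) u (a ∷ α) *ℚ fourier (suc n) v (a ∷ α) *ℚ χ (a ∷ α) (c ∷ e)
    ≡ ½ *ℚ (U false +ℚ sgn a *ℚ U true) *ℚ (½ *ℚ (V false +ℚ sgn a *ℚ V true)) *ℚ χ (a ∷ α) (c ∷ e)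
  expand a = cong (_*ℚ χ (a ∷ α) (c ∷ e)) (cong₂ _*ℚ_ (fourier-suc n u a α) (fourier-suc n v a α))
  recombine : ∀ c →
    ½ *ℚ (U false +ℚ 1ℚ *ℚ U true) *ℚ (½ *ℚ (V false +ℚ 1ℚ *ℚ V true)) *ℚ χ (false ∷ α) (c ∷ e)
      +ℚ ½ *ℚ (U false +ℚ - 1ℚ *ℚ U true) *ℚ (½ *ℚ (V false +ℚ - 1ℚ *ℚ V true)) *ℚ χ (true ∷ α) (c ∷ e)
    ≡ ½ *ℚ (U false *ℚ V c *ℚ χ α e +ℚ U true *ℚ V (not c) *ℚ χ α e)
  recombine false =
    solve 5 (λ A B C D x → con ½ :* (A :+ con 1ℚ :* B) :* (con ½ :* (C :+ con 1ℚ :* D)) :* x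
                         :+ con ½ :* (A :+ con (- 1ℚ) :* B) :* (con ½ :* (C :+ con (- 1ℚ) :* D)) :* x
                         := con ½ :* (A :* C :* x :+ B :* D :* x))
            refl (U false) (U true) (V false) (V true) (χ α e)
  recombine true =
    trans (cong (λ s → ½ *ℚ (U false +ℚ 1ℚ *ℚ U true) *ℚ (½ *ℚ (V false +ℚ 1ℚ *ℚ V true)) *ℚ χ α e
                       +ℚ ½ *ℚ (U false +ℚ - 1ℚ *ℚ U true) *ℚ (½ *ℚ (V false +ℚ - 1ℚ *ℚ V true)) *ℚ s)
                (sgn-not (dot e α)))
          (solve 5 (λ A B C D x → con ½ :* (A :+ con 1ℚ :* B) :* (con ½ :* (C :+ con 1ℚ :* D)) :* x
                                :+ con ½ :* (A :+ con (- 1ℚ) :* B) :* (con ½ :* (C :+ con (- 1ℚ) :* D)) :* (con (- 1ℚ) :* x)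
                                := con ½ :* (A :* D :* x :+ B :* C :* x))
                 refl (U false) (U true) (V false) (V true) (χ α e))

_⊕_ : ∀ {n} → Vec Bool n → Vec Bool n → Vec Bool n
_⊕_ = Vec.zipWith _xor_

Σ-fourier-correlation : ∀ n (u v : Vec Bool n → ℚ) (e : Vec Bool n) →
  Σℚ (allVecs n) (λ α → fourier n u α *ℚ fourier n v α *ℚ χ α e) ≡ mean n (λ x → u x *ℚ v (x ⊕ e))
Σ-fourier-correlation zero u v [] =
  solve 2 (λ p q → (con 1ℚ :* (p :* con 1ℚ :+ con 0ℚ)) :* (con 1ℚ :* (q :* con 1ℚ :+ con 0ℚ)) :* con 1ℚ :+ con 0ℚ
                   := con 1ℚ :* (p :* q :+ con 0ℚ)) refl (u []) (v [])
Σ-fourier-correlation (suc n) u v (c ∷ e) = begin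
  Σℚ (allVecs (suc n)) (λ β → fourier (suc n) u β *ℚ fourier (suc n) v β *ℚ χ β (c ∷ e))
    ≡⟨ Σ-allVecs-suc n (λ β → fourier (suc n) u β *ℚ fourier (suc n) v β *ℚ χ β (c ∷ e)) ⟩
  Σℚ (allVecs n) (term false) +ℚ Σℚ (allVecs n) (term true)
    ≡⟨ sym (Σ-+ (allVecs n) (term false) (term true)) ⟩
  Σℚ (allVecs n) (λ α → term false α +ℚ term true α)
    ≡⟨ Σ-cong (allVecs n) (fourier-product-suc n u v c e) ⟩
  Σℚ (allVecs n) (λ α → ½ *ℚ (P α +ℚ Q α))
    ≡⟨ Σ-*ˡ (allVecs n) ½ (λ α → P α +ℚ Q α) ⟩
  ½ *ℚ Σℚ (allVecs n) (λ α → P α +ℚ Q α)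
    ≡⟨ cong (½ *ℚ_) (Σ-+ (allVecs n) P Q) ⟩
  ½ *ℚ (Σℚ (allVecs n) P +ℚ Σℚ (allVecs n) Q)
    ≡⟨ cong₂ (λ p q → ½ *ℚ (p +ℚ q)) (Σ-fourier-correlation n (λ x → u (false ∷ x)) (λ x → v (c ∷ x)) e)
                                     (Σ-fourier-correlation n (λ x → u (true ∷ x)) (λ x → v (not c ∷ x)) e) ⟩
  ½ *ℚ (mean n (λ x → u (false ∷ x) *ℚ v (c ∷ x ⊕ e)) +ℚ mean n (λ x → u (true ∷ x) *ℚ v (not c ∷ x ⊕ e)))
    ≡⟨ sym (mean-suc n (λ x → u x *ℚ v (x ⊕ (c ∷ e)))) ⟩
  mean (suc n) (λ x → u x *ℚ v (x ⊕ (c ∷ e))) ∎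
  where
  term : Bool → Vec Bool n → ℚ
  term a α = fourier (suc n) u (a ∷ α) *ℚ fourier (suc n) v (a ∷ α) *ℚ χ (a ∷ α) (c ∷ e)
  P Q : Vec Bool n → ℚ
  P α = fourier n (λ x → u (false ∷ x)) α *ℚ fourier n (λ x → v (c ∷ x)) α *ℚ χ α e
  Q α = fourier n (λ x → u (true ∷ x)) α *ℚ fourier n (λ x → v (not c ∷ x)) α *ℚ χ α e

dot-zeros : ∀ {n} (α : Vec Bool n) → dot (replicate n false) α ≡ false
dot-zeros []      = refl
dot-zeros (a ∷ α) = dot-zeros α

dot-ones : ∀ {n} (α : Vec Bool n) → dot (replicate n true) α ≡ parity (wt α)
dot-ones []          = refl
dot-ones (false ∷ α) = dot-ones α
dot-ones (true ∷ α)  = cong not (dot-ones α)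

⊕-ones : ∀ {n} (x : Vec Bool n) → x ⊕ replicate n true ≡ complement x
⊕-ones x = trans (zipWith-replicate₂ _xor_ x true) (map-cong (λ y → xor-comm y true) x)

Σ-χ-W² : ∀ {n} (g : BF n) (e : Vec Bool n) →
  Σℚ (allVecs n) (λ α → χ α e *ℚ W² g α) ≡ mean n (λ x → sgn (g x) *ℚ sgn (g (x ⊕ e)))
Σ-χ-W² {n} g e = trans (Σ-cong (allVecs n) reorder) (Σ-fourier-correlation n u u e)
  where
  u : Vec Bool n → ℚ
  u x = sgn (g x)
  reorder : ∀ α → χ α e *ℚ W² g α ≡ fourier n u α *ℚ fourier n u α *ℚ χ α e
  reorder α = trans (cong (λ w → χ α e *ℚ (w *ℚ w)) (W≡fourier g α))
                    (solve 2 (λ s w → s :* (w :* w) := w :* w :* s) refl (χ α e) (fourier n u α))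

parseval : ∀ {n} (g : BF n) → Σℚ (allVecs n) (W² g) ≡ 1ℚ
parseval {n} g = begin
  Σℚ (allVecs n) (W² g)
    ≡⟨ Σ-cong (allVecs n) (λ α → trans (sym (*-identityˡ (W² g α))) (cong (λ d → sgn d *ℚ W² g α) (sym (dot-zeros α)))) ⟩
  Σℚ (allVecs n) (λ α → χ α (replicate n false) *ℚ W² g α)
    ≡⟨ Σ-χ-W² g (replicate n false) ⟩
  mean n (λ x → sgn (g x) *ℚ sgn (g (x ⊕ replicate n false)))
    ≡⟨ mean-cong n (λ x → trans (cong (λ y → sgn (g x) *ℚ sgn (g y)) (zipWith-identityʳ xor-identityʳ x)) (sgn² (g x))) ⟩
  mean n (λ _ → 1ℚ)
    ≡⟨ mean-const n 1ℚ ⟩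
  1ℚ ∎

complementCorrelation : ∀ {n} → BF n → ℚ
complementCorrelation {n} g = mean n (λ x → sgn (g x) *ℚ sgn (g (complement x)))

Σ-sgnwt-W² : ∀ {n} (g : BF n) → Σℚ (allVecs n) (λ α → sgnℕ (wt α) *ℚ W² g α) ≡ complementCorrelation g
Σ-sgnwt-W² {n} g = begin
  Σℚ (allVecs n) (λ α → sgnℕ (wt α) *ℚ W² g α)
    ≡⟨ Σ-cong (allVecs n) (λ α → cong (λ d → sgn d *ℚ W² g α) (sym (dot-ones α))) ⟩
  Σℚ (allVecs n) (λ α → χ α (replicate n true) *ℚ W² g α)
    ≡⟨ Σ-χ-W² g (replicate n true) ⟩
  mean n (λ x → sgn (g x) *ℚ sgn (g (x ⊕ replicate n true)))
    ≡⟨ mean-cong n (λ x → cong (λ y → sgn (g x) *ℚ sgn (g y)) (⊕-ones x)) ⟩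
  complementCorrelation g ∎

-- Influence

if-then-0≡b2q* : ∀ p (y : ℚ) → (if p then y else 0ℚ) ≡ b2q p *ℚ y
if-then-0≡b2q* false y = sym (*-zeroˡ y)
if-then-0≡b2q* true  y = sym (*-identityˡ y)

ε≡ : ∀ {n} (b : Bool) (g : BF n) → ε b g ≡ ½ *ℚ (1ℚ -ℚ sgn b *ℚ complementCorrelation g)
ε≡ {n} b g = begin
  Σℚ (allVecs n) (λ α → if parity (wt α) xor b then W² g α else 0ℚ)
    ≡⟨ Σ-cong (allVecs n) split ⟩
  Σℚ (allVecs n) (λ α → ½ *ℚ W² g α +ℚ (- ½ *ℚ sgn b) *ℚ (sgnℕ (wt α) *ℚ W² g α))
    ≡⟨ Σ-linear (allVecs n) ½ (- ½ *ℚ sgn b) (W² g) (λ α → sgnℕ (wt α) *ℚ W² g α) ⟩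
  ½ *ℚ Σℚ (allVecs n) (W² g) +ℚ (- ½ *ℚ sgn b) *ℚ Σℚ (allVecs n) (λ α → sgnℕ (wt α) *ℚ W² g α)
    ≡⟨ cong₂ (λ p q → ½ *ℚ p +ℚ (- ½ *ℚ sgn b) *ℚ q) (parseval g) (Σ-sgnwt-W² g) ⟩
  ½ *ℚ 1ℚ +ℚ (- ½ *ℚ sgn b) *ℚ complementCorrelation g
    ≡⟨ solve 2 (λ s c → con ½ :* con 1ℚ :+ (:- con ½ :* s) :* c := con ½ :* (con 1ℚ :- s :* c)) refl (sgn b) (complementCorrelation g) ⟩
  ½ *ℚ (1ℚ -ℚ sgn b *ℚ complementCorrelation g) ∎
  where
  split : ∀ α → (if parity (wt α) xor b then W² g α else 0ℚ) ≡ ½ *ℚ W² g α +ℚ (- ½ *ℚ sgn b) *ℚ (sgnℕ (wt α) *ℚ W² g α)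
  split α = trans (if-then-0≡b2q* (parity (wt α) xor b) (W² g α))
           (trans (cong (_*ℚ W² g α) (b2q-xor (parity (wt α)) b))
                  (solve 3 (λ w s y → con ½ :* (con 1ℚ :- w :* s) :* y := con ½ :* y :+ (:- con ½ :* s) :* (w :* y))
                         refl (sgnℕ (wt α)) (sgn b) (W² g α)))

influenceAt-ext-zero : ∀ {n} (b : Bool) (g : BF n) →
  influenceAt (ext b g) Fin.zero ≡ ½ *ℚ (1ℚ -ℚ sgn b *ℚ complementCorrelation g)
influenceAt-ext-zero {n} b g = begin
  influenceAt (ext b g) Fin.zero
    ≡⟨ mean-suc n (λ x → b2q (ext b g x xor ext b g (flipAt Fin.zero x))) ⟩
  ½ *ℚ (mean n disagree +ℚ mean n (λ y → b2q ((b xor g (complement y)) xor g y)))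
    ≡⟨ cong (λ m → ½ *ℚ (mean n disagree +ℚ m)) (mean-cong n (λ y → cong b2q (xor-comm (b xor g (complement y)) (g y)))) ⟩
  ½ *ℚ (mean n disagree +ℚ mean n disagree)
    ≡⟨ ½-double (mean n disagree) ⟩
  mean n disagree
    ≡⟨ mean-cong n affine ⟩
  mean n (λ y → ½ +ℚ (- ½ *ℚ sgn b) *ℚ (sgn (g y) *ℚ sgn (g (complement y))))
    ≡⟨ mean-affine n ½ (- ½ *ℚ sgn b) (λ y → sgn (g y) *ℚ sgn (g (complement y))) ⟩
  ½ +ℚ (- ½ *ℚ sgn b) *ℚ complementCorrelation g
    ≡⟨ solve 2 (λ s c → con ½ :+ (:- con ½ :* s) :* c := con ½ :* (con 1ℚ :- s :* c)) refl (sgn b) (complementCorrelation g) ⟩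
  ½ *ℚ (1ℚ -ℚ sgn b *ℚ complementCorrelation g) ∎
  where
  disagree : Vec Bool n → ℚ
  disagree y = b2q (g y xor (b xor g (complement y)))
  affine : ∀ y → disagree y ≡ ½ +ℚ (- ½ *ℚ sgn b) *ℚ (sgn (g y) *ℚ sgn (g (complement y)))
  affine y = begin
    disagree y
      ≡⟨ b2q-xor (g y) (b xor g (complement y)) ⟩
    ½ *ℚ (1ℚ -ℚ sgn (g y) *ℚ sgn (b xor g (complement y)))
      ≡⟨ cong (λ s → ½ *ℚ (1ℚ -ℚ sgn (g y) *ℚ s)) (sgn-xor b (g (complement y))) ⟩
    ½ *ℚ (1ℚ -ℚ sgn (g y) *ℚ (sgn b *ℚ sgn (g (complement y))))
      ≡⟨ solve 3 (λ u s v → con ½ :* (con 1ℚ :- u :* (s :* v)) := con ½ :+ (:- con ½ :* s) :* (u :* v))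
               refl (sgn (g y)) (sgn b) (sgn (g (complement y))) ⟩
    ½ +ℚ (- ½ *ℚ sgn b) *ℚ (sgn (g y) *ℚ sgn (g (complement y))) ∎

xor-cancelˡ : ∀ b p q → (b xor p) xor (b xor q) ≡ p xor q
xor-cancelˡ false p q = refl
xor-cancelˡ true  p q = xor-annihilates-not p q

influenceAt-ext-suc : ∀ {n} (b : Bool) (g : BF n) (i : Fin n) → influenceAt (ext b g) (Fin.suc i) ≡ influenceAt g i
influenceAt-ext-suc {n} b g i = begin
  influenceAt (ext b g) (Fin.suc i)
    ≡⟨ mean-suc n (λ x → b2q (ext b g x xor ext b g (flipAt (Fin.suc i) x))) ⟩
  ½ *ℚ (influenceAt g i +ℚ mean n (λ y → b2q ((b xor g (complement y)) xor (b xor g (complement (flipAt i y))))))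
    ≡⟨ cong (λ m → ½ *ℚ (influenceAt g i +ℚ m)) (trans (mean-cong n reflected) (mean-complement n disagree)) ⟩
  ½ *ℚ (influenceAt g i +ℚ influenceAt g i)
    ≡⟨ ½-double (influenceAt g i) ⟩
  influenceAt g i ∎
  where
  disagree : Vec Bool n → ℚ
  disagree y = b2q (g y xor g (flipAt i y))
  reflected : ∀ y → b2q ((b xor g (complement y)) xor (b xor g (complement (flipAt i y)))) ≡ disagree (complement y)
  reflected y = cong b2q (trans (xor-cancelˡ b _ _) (cong (λ z → g (complement y) xor g z) (map-updateAt y i refl)))

Inf-ext : ∀ {n} (b : Bool) (g : BF n) → Inf (ext b g) ≡ Inf g +ℚ ε b g
Inf-ext {n} b g = begin
  Inf (ext b g)
    ≡⟨ Σ-allFin-suc n (influenceAt (ext b g)) ⟩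
  influenceAt (ext b g) Fin.zero +ℚ Σℚ (List.allFin n) (λ i → influenceAt (ext b g) (Fin.suc i))
    ≡⟨ cong₂ _+ℚ_ (trans (influenceAt-ext-zero b g) (sym (ε≡ b g))) (Σ-cong (List.allFin n) (influenceAt-ext-suc b g)) ⟩
  ε b g +ℚ Inf g
    ≡⟨ +-comm (ε b g) (Inf g) ⟩
  Inf g +ℚ ε b g ∎

-- Min-entropy

square-nonNeg : ∀ p → 0ℚ ≤ p *ℚ p
square-nonNeg p@(mkℚ (+ _) _ _)   = nonNegative⁻¹ (p *ℚ p) {{nonNeg*nonNeg⇒nonNeg p p}}
square-nonNeg p@(mkℚ -[1+ _ ] _ _) =
  subst (0ℚ ≤_) (solve 1 (λ p → (:- p) :* (:- p) := p :* p) refl p)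
        (nonNegative⁻¹ ((- p) *ℚ (- p)) {{nonNeg*nonNeg⇒nonNeg (- p) (- p)}})

⨆ : ∀ {A : Set} → List A → (A → ℚ) → ℚ
⨆ xs h = List.foldr (λ x acc → h x ⊔ acc) 0ℚ xs

⨆-nonNeg : ∀ {A : Set} (xs : List A) (h : A → ℚ) → 0ℚ ≤ ⨆ xs h
⨆-nonNeg []       h = ≤-refl
⨆-nonNeg (x ∷ xs) h = p≤q⇒p≤r⊔q (h x) (⨆-nonNeg xs h)

⨆-cong : ∀ {A : Set} (xs : List A) {f h : A → ℚ} → (∀ x → f x ≡ h x) → ⨆ xs f ≡ ⨆ xs h
⨆-cong []       f≡h = refl
⨆-cong (x ∷ xs) f≡h = cong₂ _⊔_ (f≡h x) (⨆-cong xs f≡h)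

⨆-++ : ∀ {A : Set} (xs ys : List A) (h : A → ℚ) → ⨆ (xs ++ ys) h ≡ ⨆ xs h ⊔ ⨆ ys h
⨆-++ []       ys h = sym (p≤q⇒p⊔q≡q (⨆-nonNeg ys h))
⨆-++ (x ∷ xs) ys h = trans (cong (h x ⊔_) (⨆-++ xs ys h)) (sym (⊔-assoc (h x) _ _))

⨆-map : ∀ {A B : Set} (k : A → B) (xs : List A) (h : B → ℚ) → ⨆ (List.map k xs) h ≡ ⨆ xs (λ x → h (k x))
⨆-map k []       h = refl
⨆-map k (x ∷ xs) h = cong (h (k x) ⊔_) (⨆-map k xs h)

⨆-⊔ : ∀ {A : Set} (xs : List A) (f h : A → ℚ) → ⨆ xs f ⊔ ⨆ xs h ≡ ⨆ xs (λ x → f x ⊔ h x)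
⨆-⊔ []       f h = refl
⨆-⊔ (x ∷ xs) f h = trans (interchange (f x) _ (h x) _) (cong ((f x ⊔ h x) ⊔_) (⨆-⊔ xs f h))

⨆-allVecs-suc : ∀ n (h : Vec Bool (suc n) → ℚ) →
  ⨆ (allVecs (suc n)) h ≡ ⨆ (allVecs n) (λ α → h (false ∷ α) ⊔ h (true ∷ α))
⨆-allVecs-suc n h = begin
  ⨆ (allVecs (suc n)) h
    ≡⟨ ⨆-++ (List.map (false ∷_) (allVecs n)) _ h ⟩
  ⨆ (List.map (false ∷_) (allVecs n)) h ⊔ ⨆ (List.map (true ∷_) (allVecs n)) h
    ≡⟨ cong₂ _⊔_ (⨆-map (false ∷_) (allVecs n) h) (⨆-map (true ∷_) (allVecs n) h) ⟩
  ⨆ (allVecs n) (λ α → h (false ∷ α)) ⊔ ⨆ (allVecs n) (λ α → h (true ∷ α))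
    ≡⟨ ⨆-⊔ (allVecs n) (λ α → h (false ∷ α)) (λ α → h (true ∷ α)) ⟩
  ⨆ (allVecs n) (λ α → h (false ∷ α) ⊔ h (true ∷ α)) ∎

⨆-filter-nonzero : ∀ {A : Set} (f h : A → ℚ) → (∀ x → f x ≡ 0ℚ → h x ≡ 0ℚ) →
  ∀ xs → ⨆ (List.filter (λ x → ¬? (f x ≟ 0ℚ)) xs) h ≡ ⨆ xs h
⨆-filter-nonzero f h h≡0 []       = refl
⨆-filter-nonzero f h h≡0 (x ∷ xs) with f x ≟ 0ℚ
... | yes fx≡0 = trans (⨆-filter-nonzero f h h≡0 xs)
                       (sym (trans (cong (_⊔ ⨆ xs h) (h≡0 x fx≡0)) (p≤q⇒p⊔q≡q (⨆-nonNeg xs h))))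
... | no  _    = cong (h x ⊔_) (⨆-filter-nonzero f h h≡0 xs)

twoPowNegMinEntropy≡⨆ : ∀ {n} (f : BF n) → twoPowNegMinEntropy f ≡ ⨆ (allVecs n) (W² f)
twoPowNegMinEntropy≡⨆ {n} f = ⨆-filter-nonzero (W f) (W² f) (λ α Wα≡0 → cong (λ w → w *ℚ w) Wα≡0) (allVecs n)

selector-squares : ∀ p (y : ℚ) →
  (((1ℚ +ℚ sgn p) *ℚ ½) *ℚ y) *ℚ (((1ℚ +ℚ sgn p) *ℚ ½) *ℚ y)
    ⊔ (((1ℚ +ℚ sgn (not p)) *ℚ ½) *ℚ y) *ℚ (((1ℚ +ℚ sgn (not p)) *ℚ ½) *ℚ y)
  ≡ y *ℚ y
selector-squares false y =
  trans (cong₂ _⊔_ (cong (λ t → t *ℚ t) (*-identityˡ y)) (cong (λ t → t *ℚ t) (*-zeroˡ y))) (p≥q⇒p⊔q≡p (square-nonNeg y))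
selector-squares true  y =
  trans (cong₂ _⊔_ (cong (λ t → t *ℚ t) (*-zeroˡ y)) (cong (λ t → t *ℚ t) (*-identityˡ y))) (p≤q⇒p⊔q≡q (square-nonNeg y))

W²-ext-⊔ : ∀ n (g : BF n) b α → W² (ext b g) (false ∷ α) ⊔ W² (ext b g) (true ∷ α) ≡ W² g α
W²-ext-⊔ n g b α =
  trans (cong₂ _⊔_ (cong (λ w → w *ℚ w) (walsh-ext n g b false α))
                   (cong (λ w → w *ℚ w) (trans (walsh-ext n g b true α) (cong (λ k → ((1ℚ +ℚ sgnℕ k) *ℚ ½) *ℚ W g α) (+-suc (b2n b) (wt α))))))
        (selector-squares (parity (b2n b + wt α)) (W g α))

minEntropy-ext : ∀ n (g : BF n) b → twoPowNegMinEntropy (ext b g) ≡ twoPowNegMinEntropy g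
minEntropy-ext n g b = begin
  twoPowNegMinEntropy (ext b g)                                      ≡⟨ twoPowNegMinEntropy≡⨆ (ext b g) ⟩
  ⨆ (allVecs (suc n)) (W² (ext b g))                                 ≡⟨ ⨆-allVecs-suc n (W² (ext b g)) ⟩
  ⨆ (allVecs n) (λ α → W² (ext b g) (false ∷ α) ⊔ W² (ext b g) (true ∷ α)) ≡⟨ ⨆-cong (allVecs n) (W²-ext-⊔ n g b) ⟩
  ⨆ (allVecs n) (W² g)                                               ≡⟨ twoPowNegMinEntropy≡⨆ g ⟨
  twoPowNegMinEntropy g                                              ∎

proposition2 : (n : ℕ) (g : BF n) (b : Bool) →
    ((a : Bool) (α : Vec Bool n) →
      W (ext b g) (a ∷ α) ≡ ((1ℚ +ℚ sgnℕ (b2n b + wt (a ∷ α))) *ℚ ½) *ℚ W g α)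
    × (twoPowNegMinEntropy (ext b g) ≡ twoPowNegMinEntropy g)
    × (Inf (ext b g) ≡ Inf g +ℚ ε b g)
proposition2 n g b = walsh-ext n g b , minEntropy-ext n g b , Inf-ext b g
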